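{- Let $\mathcal U$ be a universe and let $\operatorname{D}:\mathcal U\to\mathcal U$ be a type family such that (a) for every $X:\mathcal U$ there is a map $\operatorname{D}(X)\to\operatorname{isProp}(X)$, and (b) $\operatorname{D}$ has conditional conjunction: for all $P,Q:\mathcal U$ there is a map $\operatorname{D}(P)\to(P\to\operatorname{D}(Q))\to\operatorname{D}(P\times Q)$. Define $\operatorname{d}(X):=\lVert \operatorname{D}(X)\rVert$. Then the following are logically equivalent: (1) for all $X,Y:\mathcal U$, $\operatorname{D}(X)\to\big(X\to\lVert\operatorname{D}(Y)\rVert\big)\to\big\lVert X\to\operatorname{D}(Y)\big\rVert$; (2) $\operatorname{d}$ satisfies the dominance axiom: for all $P,Q:\mathcal U$, $\operatorname{d}(P)\to(P\to\operatorname{d}(Q))\to\operatorname{d}(P\times Q)$.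
   Context: We work in Martin-Löf type theory with a universe $\mathcal U$, assuming function extensionality, proposition extensionality (logically equivalent propositions are equal) and propositional truncation: for each type $X$ a proposition $\lVert X\rVert$ with a map $|{ - }|:X\to\lVert X\rVert$ through which every map from $X$ to a proposition factors uniquely. A type $P$ is a proposition ($\operatorname{isProp}(P)$) if any two of its elements are equal. -}

module Defs where

open import Level using (Level; suc)
open import Data.Product using (_×_)
open import Relation.Binary.PropositionalEquality using (_≡_)

isProp : ∀ {ℓ} → Set ℓ → Set ℓ
isProp P = (x y : P) → x ≡ y

FunExt : (ℓ : Level) → Set (suc ℓ)
FunExt ℓ = {A : Set ℓ} {B : A → Set ℓ} {f g : (x : A) → B x}
         → ((x : A) → f x ≡ g x) → f ≡ g

PropExt : (ℓ : Level) → Set (suc ℓ)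
PropExt ℓ = {P Q : Set ℓ} → isProp P → isProp Q → (P → Q) → (Q → P) → P ≡ Q

-- Propositional truncation on the universe Set ℓ: a proposition ∥ X ∥ with
-- a map ∣_∣ through which every map from X into a proposition factors
-- (uniqueness of the factorisation is automatic since the target is a prop).
record PropTrunc (ℓ : Level) : Set (suc ℓ) where
  field
    ∥_∥      : Set ℓ → Set ℓ
    ∣_∣      : {X : Set ℓ} → X → ∥ X ∥
    ∥∥-isProp : {X : Set ℓ} → isProp ∥ X ∥
    ∥∥-rec   : {X P : Set ℓ} → isProp P → (X → P) → ∥ X ∥ → P

module Submission where

open import Defs
open import Level using (Level; suc)
open import Data.Product using (_×_; _,_; proj₂)
open import Function.Bundles using (_⇔_; mk⇔)
open import Relation.Binary.PropositionalEquality using (_≡_; cong; subst)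

-- (1) ⇒ (2): untruncate d(P), use (1) to obtain ∥ P → D(Q) ∥, and apply
-- conditional conjunction of D under the truncation.
-- (2) ⇒ (1): (2) yields ∥ D(X × Y) ∥. Given x : X, the proposition X × Y is
-- logically equivalent to Y, hence equal to it by propositional
-- extensionality, so D(X × Y) transports to D(Y).

module _ {ℓ : Level} where

  isProp-×⇒isPropʳ : {X Y : Set ℓ} → X → isProp (X × Y) → isProp Y
  isProp-×⇒isPropʳ x X×Y-isProp y y′ = cong proj₂ (X×Y-isProp (x , y) (x , y′))

  ×-identityˡ-≡ : PropExt ℓ → {X Y : Set ℓ} → X → isProp (X × Y) → (X × Y) ≡ Y
  ×-identityˡ-≡ pe x X×Y-isProp =
    pe X×Y-isProp (isProp-×⇒isPropʳ x X×Y-isProp) proj₂ (x ,_)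

  module _ (T : PropTrunc ℓ) where
    open PropTrunc T

    ∥∥-map : {X Y : Set ℓ} → (X → Y) → ∥ X ∥ → ∥ Y ∥
    ∥∥-map f = ∥∥-rec ∥∥-isProp (λ x → ∣ f x ∣)

    ∥∥-bind : {X Y : Set ℓ} → (X → ∥ Y ∥) → ∥ X ∥ → ∥ Y ∥
    ∥∥-bind = ∥∥-rec ∥∥-isProp

    TruncatedChoice : (Set ℓ → Set ℓ) → Set (suc ℓ)
    TruncatedChoice D = (X Y : Set ℓ) → D X → (X → ∥ D Y ∥) → ∥ (X → D Y) ∥

    DominanceAxiom : (Set ℓ → Set ℓ) → Set (suc ℓ)
    DominanceAxiom d = (P Q : Set ℓ) → d P → (P → d Q) → d (P × Q)

    module _ (D : Set ℓ → Set ℓ) where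

      D-projʳ : PropExt ℓ → ((X : Set ℓ) → D X → isProp X)
        → {X Y : Set ℓ} → D (X × Y) → X → D Y
      D-projʳ pe D⇒isProp {X} {Y} dX×Y x =
        subst D (×-identityˡ-≡ pe x (D⇒isProp (X × Y) dX×Y)) dX×Y

      truncatedChoice⇒dominanceAxiom : DominanceAxiom D
        → TruncatedChoice D → DominanceAxiom (λ X → ∥ D X ∥)
      truncatedChoice⇒dominanceAxiom conj choice P Q ∣dP∣ dQ =
        ∥∥-bind (λ dP → ∥∥-map (conj P Q dP) (choice P Q dP dQ)) ∣dP∣

      dominanceAxiom⇒truncatedChoice : PropExt ℓ → ((X : Set ℓ) → D X → isProp X)
        → DominanceAxiom (λ X → ∥ D X ∥) → TruncatedChoice D
      dominanceAxiom⇒truncatedChoice pe D⇒isProp dom X Y dX dY =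
        ∥∥-map (D-projʳ pe D⇒isProp) (dom X Y ∣ dX ∣ dY)

theorem5p32 : {ℓ : Level} → FunExt ℓ → PropExt ℓ → (T : PropTrunc ℓ)
    → let open PropTrunc T in
      (D : Set ℓ → Set ℓ)
    → ((X : Set ℓ) → D X → isProp X)
    → ((P Q : Set ℓ) → D P → (P → D Q) → D (P × Q))
    → ((X Y : Set ℓ) → D X → (X → ∥ D Y ∥) → ∥ (X → D Y) ∥)
      ⇔ ((P Q : Set ℓ) → ∥ D P ∥ → (P → ∥ D Q ∥) → ∥ D (P × Q) ∥)
theorem5p32 _ pe T D D⇒isProp conj =
  mk⇔ (truncatedChoice⇒dominanceAxiom T D conj)
      (dominanceAxiom⇒truncatedChoice T D pe D⇒isProp)
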